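{- Every graph $G$ on $16$ vertices that contains no cycle of length $5$ (as a subgraph) and has no independent set of $5$ vertices contains a subgraph isomorphic to $4K_4$, the disjoint union of four copies of the complete graph $K_4$.
   Context: Graphs are finite, simple. An independent set is a set of pairwise non-adjacent vertices. -}

module Defs where

open import Data.Nat using (ℕ)
open import Data.Fin using (Fin; zero; suc)
open import Data.Bool using (Bool; true; false)
open import Data.Product using (Σ; _×_; _,_)
open import Relation.Binary.PropositionalEquality using (_≡_; _≢_)
open import Function.Definitions using (Injective)

record Graph (n : ℕ) : Set where
  field
    adj    : Fin n → Fin n → Bool
    sym    : ∀ u v → adj u v ≡ adj v u
    irrefl : ∀ v → adj v v ≡ false

open Graph public

Adj : ∀ {n} → Graph n → Fin n → Fin n → Set
Adj G u v = adj G u v ≡ true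

next5 : Fin 5 → Fin 5
next5 zero = suc zero
next5 (suc zero) = suc (suc zero)
next5 (suc (suc zero)) = suc (suc (suc zero))
next5 (suc (suc (suc zero))) = suc (suc (suc (suc zero)))
next5 (suc (suc (suc (suc zero)))) = zero

HasC5 : ∀ {n} → Graph n → Set
HasC5 {n} G = Σ (Fin 5 → Fin n) λ c →
  Injective _≡_ _≡_ c × (∀ i → Adj G (c i) (c (next5 i)))

HasIndependentSet : ∀ {n} → Graph n → ℕ → Set
HasIndependentSet {n} G k = Σ (Fin k → Fin n) λ f →
  Injective _≡_ _≡_ f × (∀ i j → ¬Adj (f i) (f j))
  where
  ¬Adj : Fin n → Fin n → Set
  ¬Adj u v = adj G u v ≡ false

-- G contains a subgraph isomorphic to 4K4: an injective map from the
-- vertex set Fin 4 × Fin 4 of 4K4 (copy index, position) into V(G)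
-- such that any two distinct vertices of the same copy are adjacent.
Has4K4 : ∀ {n} → Graph n → Set
Has4K4 {n} G = Σ (Fin 4 × Fin 4 → Fin n) λ f →
  Injective _≡_ _≡_ f ×
  (∀ b i j → i ≢ j → Adj G (f (b , i)) (f (b , j)))

module Submission where

-- In a C5-free graph, a K4-free vertex set S with independence number α(S) ≤ 1, 2, 3, 4 has at
-- most 3, 6, 10, 15 vertices.  The case α ≤ 1 is immediate, α ≤ 2 is a case analysis around a
-- vertex of minimum degree 3, and the step to α ≤ 3, 4 uses that removing a vertex and its
-- neighbours lowers α: a larger S would have minimum degree ≥ 4, and then the neighbourhood of
-- any vertex v maps injectively onto an independent set, so deg v ≤ α(S).
--
-- Hence G, with 16 vertices and α ≤ 4, contains a K4, say K.  A vertex outside a K4 sees at most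
-- one of its vertices (two would close a 5-cycle), so removing a K4 from a set with α ≤ 3 lowers
-- α by one.  If the 12 vertices outside K have α ≤ 3, the bounds above therefore supply three
-- more disjoint K4s greedily.  Otherwise an independent 4-set outside K gives each vertex k of K
-- a private neighbour in it; then every vertex outside K sees exactly one k, those seeing k form
-- a clique of at most 3 vertices, and as they cover 12 vertices each has exactly 3.

open import Defs renaming (sym to adj-sym; irrefl to adj-irrefl)
open import Data.Bool using (Bool; true; false; _∧_; _∨_; not; if_then_else_)
open import Data.Bool.Properties using (∧-identityʳ; ∧-conicalˡ; ∧-conicalʳ; ∨-zeroʳ) renaming (_≟_ to _≟ᵇ_)
open import Data.Empty using (⊥; ⊥-elim)
open import Data.Fin using (Fin; zero; suc; inject≤; punchIn; punchOut) renaming (_<_ to _<ᶠ_)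
open import Data.Fin.Properties
  using ( _≟_; any?; all?; ¬∀⟶∃¬; pigeonhole; <⇒≢; <-cmp; suc-injective; inject≤-injective
        ; punchIn-injective; punchInᵢ≢i; punchIn-punchOut)
  renaming (_<?_ to _<ᶠ?_; <-asym to <ᶠ-asym)
open import Data.List using (List; []; _∷_; length; map; lookup; tabulate; take)
open import Data.List.Properties using (length-map; length-take)
open import Data.List.Membership.Propositional.Properties using (∈-lookup)
open import Data.List.Relation.Unary.All as All using (All; []; _∷_)
import Data.List.Relation.Unary.All.Properties as All
open import Data.List.Relation.Unary.Any as Any using (Any)
open import Data.List.Relation.Unary.AllPairs as AllPairs using (AllPairs; []; _∷_)
import Data.List.Relation.Unary.AllPairs.Properties as AllPairs
open import Data.List.Relation.Unary.Unique.Propositional using (Unique)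
import Data.List.Relation.Unary.Unique.Propositional.Properties as Unique
open import Data.Nat using (ℕ; zero; suc; _+_; _*_; _≤_; _<_; _≤?_; z≤n; s≤s)
import Data.Nat.Properties as ℕ
open import Data.Nat.Properties
  using ( n≢0⇒n>0; ≤-refl; ≤-trans; ≤-reflexive; n≤1+n; +-suc; +-monoʳ-≤; +-monoˡ-≤; +-mono-≤
        ; m≤n⇒m≤1+n; ≰⇒>; ≤-pred; <⇒≱; m≤n⇒m⊓n≡m; +-cancelʳ-≤; +-cancelˡ-≤; module ≤-Reasoning)
  renaming (_≟_ to _≟ℕ_)
open import Data.Product using (Σ; ∃; _×_; _,_; _,′_; proj₁; proj₂; map₂)
open import Function using (_∘_; case_of_)
open import Function.Definitions using (Injective)
open import Relation.Binary.Definitions using (Symmetric; tri<; tri≈; tri>)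
open import Relation.Binary.PropositionalEquality
open import Relation.Nullary using (¬_; ¬?; Dec; yes; no; does)
open import Relation.Nullary.Decidable using (map′; _×-dec_; dec-true)

AllPairs-lookup : ∀ {A : Set} {R : A → A → Set} → Symmetric R →
                  ∀ {xs} → AllPairs R xs → ∀ {i j} → i ≢ j → R (lookup xs i) (lookup xs j)
AllPairs-lookup R-sym (_  ∷ _)   {zero}  {zero}  0≢0 = ⊥-elim (0≢0 refl)
AllPairs-lookup R-sym (Rx ∷ _)   {zero}  {suc j} _   = All.lookup Rx (∈-lookup j)
AllPairs-lookup R-sym (Rx ∷ _)   {suc i} {zero}  _   = R-sym (All.lookup Rx (∈-lookup i))
AllPairs-lookup R-sym (_  ∷ Rxs) {suc i} {suc j} i≢j = AllPairs-lookup R-sym Rxs (i≢j ∘ cong suc)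

lookup-injective : ∀ {A : Set} {xs : List A} → Unique xs → ∀ {i j} → lookup xs i ≡ lookup xs j → i ≡ j
lookup-injective unique {i} {j} eq with i ≟ j
... | yes i≡j = i≡j
... | no  i≢j = ⊥-elim (AllPairs-lookup ≢-sym unique i≢j eq)

AllPairs-map-within : ∀ {A : Set} {P : A → Set} {R Q : A → A → Set} →
                      (∀ {x y} → P x → P y → R x y → Q x y) →
                      ∀ {xs} → All P xs → AllPairs R xs → AllPairs Q xs
AllPairs-map-within f []         []         = []
AllPairs-map-within f (px ∷ pxs) (Rx ∷ Rxs) =
  All.zipWith (λ (py , Rxy) → f px py Rxy) (pxs , Rx) ∷ AllPairs-map-within f pxs Rxs

two-others : ∀ {i j : Fin 4} → i ≢ j →
             Σ (Fin 4) λ p → Σ (Fin 4) λ q → p ≢ i × p ≢ j × q ≢ i × q ≢ j × p ≢ q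
two-others {i} {j} i≢j =
  outside zero , outside (suc zero)
  , punchInᵢ≢i i _ , ≢j zero , punchInᵢ≢i i _ , ≢j (suc zero)
  , λ eq → case punchIn-injective j′ zero (suc zero) (punchIn-injective i _ _ eq) of λ ()
  where
  j′ : Fin 3
  j′ = punchOut i≢j
  outside : Fin 2 → Fin 4
  outside r = punchIn i (punchIn j′ r)
  ≢j : ∀ r → outside r ≢ j
  ≢j r eq = punchInᵢ≢i j′ r (punchIn-injective i _ _ (trans eq (sym (punchIn-punchOut i≢j))))

∃-list? : ∀ {n} {P : List (Fin n) → Set} → (∀ xs → Dec (P xs)) →
          ∀ k → Dec (∃ λ xs → length xs ≡ k × P xs)
∃-list? P? zero    = map′ (λ p → [] , refl , p) (λ { ([] , _ , p) → p }) (P? [])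
∃-list? P? (suc k) =
  map′ (λ (x , xs , len , p) → x ∷ xs , cong suc len , p)
       (λ { (x ∷ xs , len , p) → x , xs , ℕ.suc-injective len , p })
       (any? λ x → ∃-list? (P? ∘ (x ∷_)) k)

-- Finite vertex sets and counting

FinSet : ℕ → Set
FinSet n = Fin n → Bool

infix 4 _∈_ _∉_ _⊆_

_∈_ _∉_ : ∀ {n} → Fin n → FinSet n → Set
x ∈ S = S x ≡ true
x ∉ S = ¬ x ∈ S

_⊆_ : ∀ {n} → FinSet n → FinSet n → Set
S ⊆ T = ∀ {x} → x ∈ S → x ∈ T

_∈?_ : ∀ {n} (x : Fin n) S → Dec (x ∈ S)
x ∈? S = S x ≟ᵇ true

full : ∀ {n} → FinSet n
full _ = true

⊆full : ∀ {n} (xs : List (Fin n)) → All (_∈ full) xs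
⊆full = All.universal λ _ → refl

count : ∀ {n} → FinSet n → ℕ
count {zero}  S = 0
count {suc n} S = if S zero then suc (count (S ∘ suc)) else count (S ∘ suc)

count-cong : ∀ {n} {S T : FinSet n} → (∀ x → S x ≡ T x) → count S ≡ count T
count-cong {zero}  S≗T = refl
count-cong {suc n} S≗T =
  cong₂ (λ b c → if b then suc c else c) (S≗T zero) (count-cong (S≗T ∘ suc))

count-full : ∀ n → count (full {n}) ≡ n
count-full zero    = refl
count-full (suc n) = cong suc (count-full n)

count-mono : ∀ {n} {S T : FinSet n} → S ⊆ T → count S ≤ count T
count-mono {zero}          S⊆T = z≤n
count-mono {suc n} {S} {T} S⊆T with S zero in e | T zero in f | count-mono {S = S ∘ suc} {T ∘ suc} S⊆T
... | true  | true  | ih = s≤s ih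
... | true  | false | _  with () ← trans (sym (S⊆T e)) f
... | false | true  | ih = m≤n⇒m≤1+n ih
... | false | false | ih = ih

0<count⇒∃∈ : ∀ {n} (S : FinSet n) → 0 < count S → ∃ λ x → x ∈ S
0<count⇒∃∈ {suc n} S 0<c with S zero in e
... | true  = zero , e
... | false with x , x∈S ← 0<count⇒∃∈ (S ∘ suc) 0<c = suc x , x∈S

∈⇒0<count : ∀ {n} (S : FinSet n) {x} → x ∈ S → 0 < count S
∈⇒0<count S {zero}  x∈S rewrite x∈S = s≤s z≤n
∈⇒0<count S {suc x} x∈S with S zero
... | true  = s≤s z≤n
... | false = ∈⇒0<count (S ∘ suc) x∈S

infixl 6 _∪_
infixl 7 _∩_ _─_

-- Opaque so that unification treats S ∩ T etc. as rigid and recovers the sets from membership types.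
opaque

  _∩_ _∪_ _─_ : ∀ {n} → FinSet n → FinSet n → FinSet n
  (S ∩ T) x = S x ∧ T x
  (S ∪ T) x = S x ∨ T x
  (S ─ T) x = S x ∧ not (T x)

  ⁅_⁆ : ∀ {n} → Fin n → FinSet n
  ⁅ y ⁆ x = does (x ≟ y)

  ⋃ : ∀ {m n} → (Fin m → FinSet n) → FinSet n
  ⋃ {zero}  F _ = false
  ⋃ {suc m} F   = F zero ∪ ⋃ (F ∘ suc)

  ∈∩⁺ : ∀ {n} {S T : FinSet n} {x} → x ∈ S → x ∈ T → x ∈ S ∩ T
  ∈∩⁺ = cong₂ _∧_

  ∈∩⁻ : ∀ {n} {S T : FinSet n} {x} → x ∈ S ∩ T → x ∈ S × x ∈ T
  ∈∩⁻ {S = S} {T} {x} x∈S∩T = ∧-conicalˡ (S x) (T x) x∈S∩T , ∧-conicalʳ (S x) (T x) x∈S∩T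

  ∈∪⁺ˡ : ∀ {n} {S T : FinSet n} {x} → x ∈ S → x ∈ S ∪ T
  ∈∪⁺ˡ {T = T} {x} x∈S = cong (_∨ T x) x∈S

  ∈∪⁺ʳ : ∀ {n} {S T : FinSet n} {x} → x ∈ T → x ∈ S ∪ T
  ∈∪⁺ʳ {S = S} {x = x} x∈T = trans (cong (S x ∨_) x∈T) (∨-zeroʳ (S x))

  ∈─⁺ : ∀ {n} {S T : FinSet n} {x} → x ∈ S → x ∉ T → x ∈ S ─ T
  ∈─⁺ {T = T} {x} x∈S x∉T with T x
  ... | true  = ⊥-elim (x∉T refl)
  ... | false = cong (_∧ true) x∈S

  ∈─⁻ : ∀ {n} {S T : FinSet n} {x} → x ∈ S ─ T → x ∈ S × x ∉ T
  ∈─⁻ {S = S} {T} {x} x∈S─T =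
    ∧-conicalˡ (S x) (not (T x)) x∈S─T ,
    λ x∈T → case trans (sym (cong not x∈T)) (∧-conicalʳ (S x) (not (T x)) x∈S─T) of λ ()

  x∈⁅x⁆ : ∀ {n} {x : Fin n} → x ∈ ⁅ x ⁆
  x∈⁅x⁆ {x = x} = dec-true (x ≟ x) refl

  ∈⁅⁆⇒≡ : ∀ {n} {x y : Fin n} → x ∈ ⁅ y ⁆ → x ≡ y
  ∈⁅⁆⇒≡ {x = x} {y} x∈⁅y⁆ with x ≟ y
  ... | yes x≡y = x≡y
  ... | no  _   with () ← x∈⁅y⁆

  ∈⋃⁺ : ∀ {m n} (F : Fin m → FinSet n) {x} t → x ∈ F t → x ∈ ⋃ F
  ∈⋃⁺ F zero    x∈F = ∈∪⁺ˡ {S = F zero} {⋃ (F ∘ suc)} x∈F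
  ∈⋃⁺ F (suc t) x∈F = ∈∪⁺ʳ {S = F zero} {⋃ (F ∘ suc)} (∈⋃⁺ (F ∘ suc) t x∈F)

  count-split : ∀ {n} (S T : FinSet n) → count S ≡ count (S ∩ T) + count (S ─ T)
  count-split {zero}  S T = refl
  count-split {suc n} S T with S zero | T zero | count-split (S ∘ suc) (T ∘ suc)
  ... | true  | true  | ih = cong suc ih
  ... | true  | false | ih = trans (cong suc ih) (sym (+-suc _ _))
  ... | false | _     | ih = ih

  count-∪ : ∀ {n} (S T : FinSet n) → count (S ∪ T) ≤ count S + count T
  count-∪ {zero}  S T = z≤n
  count-∪ {suc n} S T with S zero | T zero | count-∪ (S ∘ suc) (T ∘ suc)
  ... | true  | true  | ih = s≤s (≤-trans ih (+-monoʳ-≤ (count (S ∘ suc)) (n≤1+n _)))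
  ... | true  | false | ih = s≤s ih
  ... | false | true  | ih = ≤-trans (s≤s ih) (≤-reflexive (sym (+-suc _ _)))
  ... | false | false | ih = ih

  count-⋃ : ∀ {m n b} (F : Fin m → FinSet n) → (∀ t → count (F t) ≤ b) → count (⋃ F) ≤ m * b
  count-⋃ {zero}  {n} F _ = ≤-reflexive (count-false n)
    where
    count-false : ∀ n → count {n} (λ _ → false) ≡ 0
    count-false zero    = refl
    count-false (suc n) = count-false n
  count-⋃ {suc m} F c≤b =
    ≤-trans (count-∪ (F zero) (⋃ (F ∘ suc))) (+-mono-≤ (c≤b zero) (count-⋃ (F ∘ suc) (c≤b ∘ suc)))

  count-─⁅⁆ : ∀ {n} (S : FinSet n) {y} → y ∈ S → count S ≡ suc (count (S ─ ⁅ y ⁆))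
  count-─⁅⁆ S {zero} y∈S rewrite y∈S =
    cong suc (count-cong (λ x → sym (∧-identityʳ (S (suc x)))))
  count-─⁅⁆ S {suc y} y∈S with S zero | count-─⁅⁆ (S ∘ suc) y∈S
  ... | true  | ih = cong suc ih
  ... | false | ih = ih

∈─⁅⁆⁺ : ∀ {n} {S : FinSet n} {x y} → x ∈ S → x ≢ y → x ∈ S ─ ⁅ y ⁆
∈─⁅⁆⁺ x∈S x≢y = ∈─⁺ x∈S (x≢y ∘ ∈⁅⁆⇒≡)

∈─⁅⁆⁻ : ∀ {n} {S : FinSet n} {x y} → x ∈ S ─ ⁅ y ⁆ → x ∈ S × x ≢ y
∈─⁅⁆⁻ x∈S─y with x∈S , x∉⁅y⁆ ← ∈─⁻ x∈S─y = x∈S , λ { refl → x∉⁅y⁆ x∈⁅x⁆ }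

another-member : ∀ {n} (S : FinSet n) → 1 < count S → ∀ y → ∃ λ x → x ∈ S × x ≢ y
another-member S 1<c y with S y in e
... | false with x , x∈S ← 0<count⇒∃∈ S (≤-pred (m≤n⇒m≤1+n 1<c)) =
  x , x∈S , λ { refl → case trans (sym x∈S) e of λ () }
... | true  with x , x∈S─y ← 0<count⇒∃∈ (S ─ ⁅ y ⁆) (≤-pred (subst (1 <_) (count-─⁅⁆ S e) 1<c)) =
  x , ∈─⁅⁆⁻ x∈S─y

count≤1⇒≡ : ∀ {n} (S : FinSet n) → count S ≤ 1 → ∀ {x y} → x ∈ S → y ∈ S → x ≡ y
count≤1⇒≡ S c≤1 {x} {y} x∈S y∈S with x ≟ y
... | yes x≡y = x≡y
... | no  x≢y = ⊥-elim (<⇒≱ 1<c c≤1)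
  where
  1<c : 1 < count S
  1<c = subst (1 <_) (sym (count-─⁅⁆ S y∈S)) (s≤s (∈⇒0<count (S ─ ⁅ y ⁆) (∈─⁅⁆⁺ x∈S x≢y)))

≡⇒count≤1 : ∀ {n} (S : FinSet n) → (∀ {x y} → x ∈ S → y ∈ S → x ≡ y) → count S ≤ 1
≡⇒count≤1 S unique with 2 ≤? count S
... | no  2≰c = ≤-pred (≰⇒> 2≰c)
... | yes 1<c with y , y∈S ← 0<count⇒∃∈ S (≤-trans (s≤s z≤n) 1<c)
  with x , x∈S , x≢y ← another-member S 1<c y = ⊥-elim (x≢y (unique x∈S y∈S))

length≤count : ∀ {n} (S : FinSet n) {xs} → Unique xs → All (_∈ S) xs → length xs ≤ count S
length≤count S {[]}     []               []           = z≤n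
length≤count S {x ∷ xs} (x∉xs ∷ unique) (x∈S ∷ xs⊆S) =
  subst (suc (length xs) ≤_) (sym (count-─⁅⁆ S x∈S))
    (s≤s (length≤count (S ─ ⁅ x ⁆) unique
      (All.zipWith (λ (y∈S , x≢y) → ∈─⁅⁆⁺ y∈S (≢-sym x≢y)) (xs⊆S , x∉xs))))

enumerate : ∀ {n} (S : FinSet n) →
            Σ (List (Fin n)) λ xs → Unique xs × All (_∈ S) xs × length xs ≡ count S
enumerate {zero}  S = [] , [] , [] , refl
enumerate {suc n} S with enumerate (S ∘ suc)
... | xs , unique , xs⊆S , len with S zero in e
...   | true  = zero ∷ map suc xs
              , All.map⁺ (All.map (λ _ ()) xs⊆S) ∷ Unique.map⁺ suc-injective unique
              , e ∷ All.map⁺ xs⊆S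
              , cong suc (trans (length-map suc xs) len)
...   | false = map suc xs
              , Unique.map⁺ suc-injective unique
              , All.map⁺ xs⊆S
              , trans (length-map suc xs) len

distinct-members : ∀ {n} (S : FinSet n) {k} → k ≤ count S →
                   Σ (Fin k → Fin n) λ f → Injective _≡_ _≡_ f × (∀ i → f i ∈ S)
distinct-members {n} S {k} k≤c with xs , unique , xs⊆S , len ← enumerate S =
  f , (λ eq → inject≤-injective k≤len k≤len _ _ (lookup-injective unique eq))
    , (λ i → All.lookup xs⊆S (∈-lookup (inject≤ i k≤len)))
  where
  k≤len : k ≤ length xs
  k≤len = ≤-trans k≤c (≤-reflexive (sym len))
  f : Fin k → Fin n
  f i = lookup xs (inject≤ i k≤len)

choose : ∀ {n} → FinSet n → Fin n → Fin n
choose S d with any? (_∈? S)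
... | yes (x , _) = x
... | no  _       = d

choose-∈ : ∀ {n} (S : FinSet n) {d x} → x ∈ S → choose S d ∈ S
choose-∈ S {x = x} x∈S with any? (_∈? S)
... | yes (_ , y∈S) = y∈S
... | no  ∄        = ⊥-elim (∄ (x , x∈S))

-- Graphs

module Basics {n : ℕ} (G : Graph n) where

  infix 4 _~_ _≁_

  _~_ _≁_ : Fin n → Fin n → Set
  x ~ y = Adj G x y
  x ≁ y = ¬ x ~ y

  ~-sym : ∀ {x y} → x ~ y → y ~ x
  ~-sym {x} {y} = trans (adj-sym G y x)

  ≁-sym : ∀ {x y} → x ≁ y → y ≁ x
  ≁-sym x≁y = x≁y ∘ ~-sym

  ~⇒≢ : ∀ {x y} → x ~ y → x ≢ y
  ~⇒≢ {x} x~x refl = case trans (sym x~x) (adj-irrefl G x) of λ ()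

  _~?_ : ∀ x y → Dec (x ~ y)
  x ~? y = adj G x y ≟ᵇ true

  Independent : List (Fin n) → Set
  Independent = AllPairs (λ x y → x ≢ y × x ≁ y)

  α[_]≤_ : FinSet n → ℕ → Set
  α[ S ]≤ m = ∀ {xs} → Independent xs → All (_∈ S) xs → length xs ≤ m

  IsClique : ∀ {m} → (Fin m → Fin n) → Set
  IsClique k = ∀ {i j} → i ≢ j → k i ~ k j

  Clique4 : FinSet n → Set
  Clique4 S = Σ (Fin 4 → Fin n) λ k → IsClique k × (∀ i → k i ∈ S)

  K4-free : FinSet n → Set
  K4-free S = ¬ Clique4 S

  K4-free-mono : ∀ {S T} → S ⊆ T → K4-free T → K4-free S
  K4-free-mono S⊆T free (k , k~ , k∈S) = free (k , k~ , λ i → S⊆T (k∈S i))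

  clique-injective : ∀ {m} {k : Fin m → Fin n} → IsClique k → Injective _≡_ _≡_ k
  clique-injective k~ {i} {j} ki≡kj with i ≟ j
  ... | yes i≡j = i≡j
  ... | no  i≢j = ⊥-elim (~⇒≢ (k~ i≢j) ki≡kj)

  clique4 : ∀ {S a b c d} → a ~ b → a ~ c → a ~ d → b ~ c → b ~ d → c ~ d →
            All (_∈ S) (a ∷ b ∷ c ∷ d ∷ []) → Clique4 S
  clique4 {a = a} {b} {c} {d} ab ac ad bc bd cd abcd⊆S =
    lookup abcd , AllPairs-lookup ~-sym {abcd} ((ab ∷ ac ∷ ad ∷ []) ∷ (bc ∷ bd ∷ []) ∷ (cd ∷ []) ∷ [] ∷ [])
    , λ i → All.lookup abcd⊆S (∈-lookup i)
    where
    abcd : List (Fin n)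
    abcd = a ∷ b ∷ c ∷ d ∷ []

  clique4? : ∀ S → Dec (Clique4 S)
  clique4? S = map′ from to (∃-list? (λ xs → AllPairs.allPairs? _~?_ xs ×-dec All.all? (_∈? S) xs) 4)
    where
    from : (∃ λ xs → length xs ≡ 4 × AllPairs _~_ xs × All (_∈ S) xs) → Clique4 S
    from (_ ∷ _ ∷ _ ∷ _ ∷ [] , refl , ((ab ∷ ac ∷ ad ∷ []) ∷ (bc ∷ bd ∷ []) ∷ (cd ∷ []) ∷ [] ∷ []) , abcd⊆S) =
      clique4 ab ac ad bc bd cd abcd⊆S
    to : Clique4 S → ∃ λ xs → length xs ≡ 4 × AllPairs _~_ xs × All (_∈ S) xs
    to (k , k~ , k∈S) = tabulate k , refl , AllPairs.tabulate⁺ k~ , All.tabulate⁺ k∈S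

  Independent⇒HasIndependentSet : ∀ {xs} → Independent xs → HasIndependentSet G (length xs)
  Independent⇒HasIndependentSet {xs} indep =
    lookup xs , lookup-injective (AllPairs.map proj₁ indep) , nonadjacent
    where
    nonadjacent : ∀ i j → adj G (lookup xs i) (lookup xs j) ≡ false
    nonadjacent i j with i ≟ j | adj G (lookup xs i) (lookup xs j) in e
    ... | yes refl | _     = trans (sym e) (adj-irrefl G (lookup xs i))
    ... | no  i≢j  | true  = ⊥-elim (proj₂ (AllPairs-lookup (λ (x≢y , x≁y) → ≢-sym x≢y , ≁-sym x≁y) indep i≢j) e)
    ... | no  _    | false = refl

  IndependentSet : FinSet n → ℕ → Set
  IndependentSet S k = ∃ λ xs → length xs ≡ k × Independent xs × All (_∈ S) xs

  independent-set? : ∀ S k → Dec (IndependentSet S k)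
  independent-set? S = ∃-list? λ xs → AllPairs.allPairs? distinct-nonadjacent? xs ×-dec All.all? (_∈? S) xs
    where
    distinct-nonadjacent? : ∀ x y → Dec (x ≢ y × x ≁ y)
    distinct-nonadjacent? x y = ¬? (x ≟ y) ×-dec ¬? (x ~? y)

  ¬IndependentSet⇒α≤ : ∀ {S m} → ¬ IndependentSet S (suc m) → α[ S ]≤ m
  ¬IndependentSet⇒α≤ {S} {m} ∄I {xs} indep xs⊆S with suc m ≤? length xs
  ... | no  m≱len = ≤-pred (≰⇒> m≱len)
  ... | yes m<len =
    ⊥-elim (∄I (take (suc m) xs , length-prefix , AllPairs.take⁺ (suc m) indep , All.take⁺ (suc m) xs⊆S))
    where
    length-prefix : length (take (suc m) xs) ≡ suc m
    length-prefix = trans (length-take (suc m) xs) (m≤n⇒m⊓n≡m m<len)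

  ¬HasIndependentSet⇒α≤ : ∀ {m} → ¬ HasIndependentSet G (suc m) → ∀ S → α[ S ]≤ m
  ¬HasIndependentSet⇒α≤ ∄I S = ¬IndependentSet⇒α≤ λ (_ , len , indep , _) →
    ∄I (subst (HasIndependentSet G) len (Independent⇒HasIndependentSet indep))

  nbhd non-nbhd : FinSet n → Fin n → FinSet n
  nbhd     S v = S ∩ adj G v
  non-nbhd S v = S ─ adj G v ─ ⁅ v ⁆

  degree : FinSet n → Fin n → ℕ
  degree S v = count (nbhd S v)

  module Neighbourhood (S : FinSet n) (v : Fin n) where

    N W : FinSet n
    N = nbhd S v
    W = non-nbhd S v

    N⊆S : N ⊆ S
    N⊆S = proj₁ ∘ ∈∩⁻

    N⇒~ : ∀ {x} → x ∈ N → v ~ x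
    N⇒~ = proj₂ ∘ ∈∩⁻

    ∈N⁺ : ∀ {x} → x ∈ S → v ~ x → x ∈ N
    ∈N⁺ = ∈∩⁺

    W⊆S : W ⊆ S
    W⊆S = proj₁ ∘ ∈─⁻ ∘ proj₁ ∘ ∈─⁅⁆⁻

    W⇒≁ : ∀ {x} → x ∈ W → v ≁ x
    W⇒≁ = proj₂ ∘ ∈─⁻ ∘ proj₁ ∘ ∈─⁅⁆⁻

    W⇒≢ : ∀ {x} → x ∈ W → x ≢ v
    W⇒≢ = proj₂ ∘ ∈─⁅⁆⁻

    ∈W⁺ : ∀ {x} → x ∈ S → v ≁ x → x ≢ v → x ∈ W
    ∈W⁺ x∈S v≁x x≢v = ∈─⁅⁆⁺ (∈─⁺ x∈S v≁x) x≢v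

    N⇒W⇒≢ : ∀ {x y} → x ∈ N → y ∈ W → x ≢ y
    N⇒W⇒≢ x∈N y∈W refl = W⇒≁ y∈W (N⇒~ x∈N)

  count-by-nbhd : ∀ {S v} → v ∈ S → count S ≡ suc (degree S v + count (non-nbhd S v))
  count-by-nbhd {S} {v} v∈S = begin
    count S                                  ≡⟨ count-split S (adj G v) ⟩
    degree S v + count (S ─ adj G v)         ≡⟨ cong (degree S v +_) (count-─⁅⁆ (S ─ adj G v) v∈S─nbrs) ⟩
    degree S v + suc (count (non-nbhd S v))  ≡⟨ +-suc _ _ ⟩
    suc (degree S v + count (non-nbhd S v))  ∎
    where
    open ≡-Reasoning
    v∈S─nbrs : v ∈ S ─ adj G v
    v∈S─nbrs = ∈─⁺ v∈S λ v~v → ~⇒≢ v~v refl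

  α-non-nbhd : ∀ {S v m} → v ∈ S → α[ S ]≤ suc m → α[ non-nbhd S v ]≤ m
  α-non-nbhd {S} {v} v∈S α≤1+m indep xs⊆W =
    ≤-pred (α≤1+m (All.map (λ x∈W → ≢-sym (W⇒≢ x∈W) , W⇒≁ x∈W) xs⊆W ∷ indep)
                  (v∈S ∷ All.map W⊆S xs⊆W))
    where open Neighbourhood S v

  min-degree : ∀ {S m b d} → K4-free S → α[ S ]≤ suc m →
               (∀ {T} → K4-free T → α[ T ]≤ m → count T ≤ b) →
               suc (d + b) ≤ count S → ∀ {v} → v ∈ S → d ≤ degree S v
  min-degree {S} {m} {b} {d} free α≤1+m bound 1+d+b≤c {v} v∈S = +-cancelʳ-≤ b d (degree S v) (begin
    d + b                              ≤⟨ ≤-pred (≤-trans 1+d+b≤c (≤-reflexive (count-by-nbhd v∈S))) ⟩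
    degree S v + count (non-nbhd S v)  ≤⟨ +-monoʳ-≤ (degree S v) W-bound ⟩
    degree S v + b                     ∎)
    where
    open ≤-Reasoning
    W-bound : count (non-nbhd S v) ≤ b
    W-bound = bound (K4-free-mono {non-nbhd S v} {S} (Neighbourhood.W⊆S S v) free) (α-non-nbhd v∈S α≤1+m)

  α≤1⇒~ : ∀ {S} → α[ S ]≤ 1 → ∀ {x y} → x ∈ S → y ∈ S → x ≢ y → x ~ y
  α≤1⇒~ α≤1 {x} {y} x∈S y∈S x≢y with x ~? y
  ... | yes x~y = x~y
  ... | no  x≁y = case α≤1 (((x≢y , x≁y) ∷ []) ∷ [] ∷ []) (x∈S ∷ y∈S ∷ []) of λ { (s≤s ()) }

  α≤1⇒count≤3 : ∀ {S} → K4-free S → α[ S ]≤ 1 → count S ≤ 3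
  α≤1⇒count≤3 {S} free α≤1 with 4 ≤? count S
  ... | no  4≰c = ≤-pred (≰⇒> 4≰c)
  ... | yes 4≤c with k , k-injective , k∈S ← distinct-members S 4≤c =
    ⊥-elim (free (k , (λ i≢j → α≤1⇒~ α≤1 (k∈S _) (k∈S _) (i≢j ∘ k-injective)) , k∈S))

  vertices : ∀ {m} → (Fin m → Fin n) → FinSet n
  vertices k = ⋃ (⁅_⁆ ∘ k)

  ∈vertices : ∀ {m} (k : Fin m → Fin n) i → k i ∈ vertices k
  ∈vertices k i = ∈⋃⁺ (⁅_⁆ ∘ k) i x∈⁅x⁆

  ∉vertices : ∀ {m} {k : Fin m → Fin n} {x} → x ∉ vertices k → ∀ i → x ≢ k i
  ∉vertices {k = k} x∉k i refl = x∉k (∈vertices k i)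

  count-─vertices : ∀ {m} S (k : Fin m → Fin n) → count S ≤ m + count (S ─ vertices k)
  count-─vertices {m} S k = begin
    count S                                         ≡⟨ count-split S (vertices k) ⟩
    count (S ∩ vertices k) + count (S ─ vertices k) ≤⟨ +-monoˡ-≤ _ (count-mono {n} (proj₂ ∘ ∈∩⁻)) ⟩
    count (vertices k) + count (S ─ vertices k)     ≤⟨ +-monoˡ-≤ _ count-vertices ⟩
    m + count (S ─ vertices k)                      ∎
    where
    open ≤-Reasoning
    count-vertices : count (vertices k) ≤ m
    count-vertices = subst (count (vertices k) ≤_) (ℕ.*-identityʳ m)
      (count-⋃ (⁅_⁆ ∘ k) λ i → ≡⇒count≤1 ⁅ k i ⁆ λ x∈ y∈ → trans (∈⁅⁆⇒≡ x∈) (sym (∈⁅⁆⇒≡ y∈)))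

  Packing : FinSet n → ℕ → Set
  Packing S m = Σ (Fin m × Fin 4 → Fin n) λ f →
    Injective _≡_ _≡_ f × (∀ b {i j} → i ≢ j → f (b , i) ~ f (b , j)) × (∀ p → f p ∈ S)

  Packing⇒Has4K4 : ∀ {S} → Packing S 4 → Has4K4 G
  Packing⇒Has4K4 (f , f-injective , f~ , _) = f , f-injective , λ b _ _ → f~ b

  empty-packing : ∀ {S} → Packing S 0
  empty-packing = (λ ()) , (λ {p} _ → case proj₁ p of λ ()) , (λ ()) , λ ()

  extend-packing : ∀ {S m} ((k , _) : Clique4 S) → Packing (S ─ vertices k) m → Packing S (suc m)
  extend-packing {S} (k , k~ , k∈S) (f , f-injective , f~ , f∈) = g , g-injective , g~ , g∈
    where
    g : Fin (suc _) × Fin 4 → Fin n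
    g (zero  , i) = k i
    g (suc b , i) = f (b , i)
    k≢f : ∀ {i p} → k i ≢ f p
    k≢f {i} {p} ki≡fp = proj₂ (∈─⁻ (f∈ p)) (subst (_∈ vertices k) ki≡fp (∈vertices k i))
    g-injective : Injective _≡_ _≡_ g
    g-injective {zero  , i} {zero  , j} eq = cong (zero ,_) (clique-injective k~ eq)
    g-injective {zero  , i} {suc _ , j} eq = ⊥-elim (k≢f eq)
    g-injective {suc _ , i} {zero  , j} eq = ⊥-elim (k≢f (sym eq))
    g-injective {suc b , i} {suc c , j} eq = cong (λ (b , i) → suc b , i) (f-injective {b , i} {c , j} eq)
    g~ : ∀ b {i j} → i ≢ j → g (b , i) ~ g (b , j)
    g~ zero    = k~
    g~ (suc b) = f~ b
    g∈ : ∀ p → g p ∈ S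
    g∈ (zero  , i) = k∈S i
    g∈ (suc b , i) = proj₁ (∈─⁻ (f∈ (b , i)))

-- C5-free graphs

module WithoutC5 {n : ℕ} {G : Graph n} (no-C5 : ¬ HasC5 G) where

  open Basics G

  no-5-cycle : ∀ {a b c d e} → a ~ b → b ~ c → c ~ d → d ~ e → e ~ a →
               a ≢ c → a ≢ d → b ≢ d → b ≢ e → c ≢ e → ⊥
  no-5-cycle {a} {b} {c} {d} {e} ab bc cd de ea a≢c a≢d b≢d b≢e c≢e =
    no-C5 (lookup cycle , lookup-injective distinct , edge)
    where
    cycle : List (Fin n)
    cycle = a ∷ b ∷ c ∷ d ∷ e ∷ []
    distinct : Unique cycle
    distinct = (~⇒≢ ab ∷ a≢c ∷ a≢d ∷ ≢-sym (~⇒≢ ea) ∷ []) ∷ (~⇒≢ bc ∷ b≢d ∷ b≢e ∷ [])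
             ∷ (~⇒≢ cd ∷ c≢e ∷ []) ∷ (~⇒≢ de ∷ []) ∷ [] ∷ []
    edge : ∀ i → lookup cycle i ~ lookup cycle (next5 i)
    edge zero                          = ab
    edge (suc zero)                    = bc
    edge (suc (suc zero))              = cd
    edge (suc (suc (suc zero)))        = de
    edge (suc (suc (suc (suc zero))))  = ea

  no-K5 : ∀ {a b c d e} → a ~ b → a ~ c → a ~ d → a ~ e → b ~ c → b ~ d → b ~ e →
          c ~ d → c ~ e → d ~ e → ⊥
  no-K5 ab ac ad ae bc bd be cd ce de =
    no-5-cycle ab bc cd de (~-sym ae) (~⇒≢ ac) (~⇒≢ ad) (~⇒≢ bd) (~⇒≢ be) (~⇒≢ ce)

  K4-neighbour-unique : ∀ {k : Fin 4 → Fin n} → IsClique k → ∀ {x} → (∀ t → x ≢ k t) →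
                        ∀ {i j} → x ~ k i → x ~ k j → i ≡ j
  K4-neighbour-unique {k} k~ x∉k {i} {j} x~ki x~kj with i ≟ j
  ... | yes i≡j = i≡j
  ... | no  i≢j with p , q , p≢i , p≢j , q≢i , q≢j , p≢q ← two-others i≢j =
    ⊥-elim (no-5-cycle x~ki (k~ (≢-sym p≢i)) (k~ p≢q) (k~ q≢j) (~-sym x~kj)
                       (x∉k p) (x∉k q) (~⇒≢ (k~ (≢-sym q≢i))) (~⇒≢ (k~ i≢j)) (~⇒≢ (k~ p≢j)))

  module Around {S : FinSet n} {v : Fin n} (v∈S : v ∈ S) (free : K4-free S) where

    open Neighbourhood S v public

    N-nbrs W-nbrs : Fin n → FinSet n
    N-nbrs x = nbhd (nbhd S x) v
    W-nbrs x = non-nbhd (nbhd S x) v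

    N-nbrs⇒~ : ∀ {x y} → y ∈ N-nbrs x → x ~ y
    N-nbrs⇒~ = proj₂ ∘ ∈∩⁻ ∘ proj₁ ∘ ∈∩⁻

    N-nbrs⊆N : ∀ {x y} → y ∈ N-nbrs x → y ∈ N
    N-nbrs⊆N y∈ with y∈S∩x , v~y ← ∈∩⁻ y∈ = ∈N⁺ (proj₁ (∈∩⁻ y∈S∩x)) v~y

    ∈N-nbrs⁺ : ∀ {x y} → y ∈ N → x ~ y → y ∈ N-nbrs x
    ∈N-nbrs⁺ y∈N x~y = ∈∩⁺ (∈∩⁺ (N⊆S y∈N) x~y) (N⇒~ y∈N)

    W-nbrs⇒~ : ∀ {x y} → y ∈ W-nbrs x → x ~ y
    W-nbrs⇒~ {x} = proj₂ ∘ ∈∩⁻ ∘ Neighbourhood.W⊆S (nbhd S x) v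

    W-nbrs⊆W : ∀ {x y} → y ∈ W-nbrs x → y ∈ W
    W-nbrs⊆W {x} y∈ = ∈W⁺ (proj₁ (∈∩⁻ (W′⊆S y∈))) (W′⇒≁ y∈) (W′⇒≢ y∈)
      where open Neighbourhood (nbhd S x) v using () renaming (W⊆S to W′⊆S; W⇒≁ to W′⇒≁; W⇒≢ to W′⇒≢)

    degree-split : ∀ {x} → x ∈ N → degree S x ≡ suc (count (N-nbrs x) + count (W-nbrs x))
    degree-split x∈N = count-by-nbhd (∈∩⁺ v∈S (~-sym (N⇒~ x∈N)))

    N⇒≢v : ∀ {x} → x ∈ N → x ≢ v
    N⇒≢v x∈N = ≢-sym (~⇒≢ (N⇒~ x∈N))

    -- 5-cycle g y z v x
    no-shared-W-nbr : ∀ {x y z g} → x ∈ N → y ∈ N → z ∈ N → g ∈ W →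
                      y ~ z → y ~ g → x ≢ y → x ≢ z → ¬ x ~ g
    no-shared-W-nbr x∈N y∈N z∈N g∈W y~z y~g x≢y x≢z x~g =
      no-5-cycle (~-sym y~g) y~z (~-sym (N⇒~ z∈N)) (N⇒~ x∈N) x~g
                 (≢-sym (N⇒W⇒≢ z∈N g∈W)) (W⇒≢ g∈W) (N⇒≢v y∈N) (≢-sym x≢y) (≢-sym x≢z)

    -- 5-cycle g x v y h
    W-nbrs-nonadjacent : ∀ {x y g h} → x ∈ N → y ∈ N → g ∈ W → h ∈ W →
                         x ~ g → y ~ h → x ≢ y → g ≢ h → ¬ g ~ h
    W-nbrs-nonadjacent x∈N y∈N g∈W h∈W x~g y~h x≢y g≢h g~h =
      no-5-cycle (~-sym x~g) (~-sym (N⇒~ x∈N)) (N⇒~ y∈N) y~h (~-sym g~h)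
                 (W⇒≢ g∈W) (≢-sym (N⇒W⇒≢ y∈N g∈W)) x≢y (N⇒W⇒≢ x∈N h∈W) (≢-sym (W⇒≢ h∈W))

    -- 5-cycle g y v w x
    no-W-nbr-of-N-nbr : ∀ {x y w g} → x ∈ N → y ∈ N → w ∈ N → g ∈ W →
                        x ~ y → x ~ w → w ≢ y → y ~ g → ¬ x ~ g
    no-W-nbr-of-N-nbr x∈N y∈N w∈N g∈W x~y x~w w≢y y~g x~g =
      no-5-cycle (~-sym y~g) (~-sym (N⇒~ y∈N)) (N⇒~ w∈N) (~-sym x~w) x~g
                 (W⇒≢ g∈W) (≢-sym (N⇒W⇒≢ w∈N g∈W)) (≢-sym w≢y) (≢-sym (~⇒≢ x~y)) (≢-sym (N⇒≢v x∈N))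

    -- the K4 v x y a if a ≡ b, else the 5-cycle v a x y b
    no-adjacent-branching : ∀ {x y a b} → x ∈ N → y ∈ N → a ∈ N → b ∈ N →
                            x ~ y → x ~ a → y ~ b → a ≢ y → b ≢ x → ⊥
    no-adjacent-branching {a = a} {b} x∈N y∈N a∈N b∈N x~y x~a y~b a≢y b≢x with a ≟ b
    ... | yes refl = free (clique4 (N⇒~ x∈N) (N⇒~ y∈N) (N⇒~ a∈N) x~y x~a y~b
                                   (v∈S ∷ N⊆S x∈N ∷ N⊆S y∈N ∷ N⊆S a∈N ∷ []))
    ... | no  a≢b  = no-5-cycle (N⇒~ a∈N) (~-sym x~a) x~y y~b (~-sym (N⇒~ b∈N))
                                (≢-sym (N⇒≢v x∈N)) (≢-sym (N⇒≢v y∈N)) a≢y a≢b (≢-sym b≢x)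

    leaf-of-branching : ∀ {c l l′} → c ∈ N → l ∈ N-nbrs c → l′ ∈ N-nbrs c → l′ ≢ l →
                        count (N-nbrs l) ≤ 1
    leaf-of-branching {c} {l} {l′} c∈N l∈ l′∈ l′≢l =
      ≡⇒count≤1 (N-nbrs l) λ z∈ z′∈ → trans (only-c z∈) (sym (only-c z′∈))
      where
      only-c : ∀ {z} → z ∈ N-nbrs l → z ≡ c
      only-c {z} z∈ with z ≟ c
      ... | yes z≡c = z≡c
      ... | no  z≢c = ⊥-elim (no-adjacent-branching (N-nbrs⊆N l∈) c∈N (N-nbrs⊆N z∈) (N-nbrs⊆N l′∈)
                                (~-sym (N-nbrs⇒~ l∈)) (N-nbrs⇒~ z∈) (N-nbrs⇒~ l′∈) z≢c l′≢l)

  module Count≥7 {S : FinSet n} (free : K4-free S) (α≤2 : α[ S ]≤ 2) (7≤c : 7 ≤ count S) where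

    min-degree-3 : ∀ {x} → x ∈ S → 3 ≤ degree S x
    min-degree-3 = min-degree free α≤2 α≤1⇒count≤3 7≤c

    v : Fin n
    v = proj₁ (0<count⇒∃∈ S (≤-trans (s≤s z≤n) 7≤c))

    v∈S : v ∈ S
    v∈S = proj₂ (0<count⇒∃∈ S (≤-trans (s≤s z≤n) 7≤c))

    open Around {S} {v} v∈S free

    no-independent-triple : ∀ {a b c} → Independent (a ∷ b ∷ c ∷ []) → All (_∈ S) (a ∷ b ∷ c ∷ []) → ⊥
    no-independent-triple indep abc⊆S = case α≤2 indep abc⊆S of λ { (s≤s (s≤s ())) }

    N-and-W-nbrs : ∀ {x} → x ∈ N → 2 ≤ count (N-nbrs x) + count (W-nbrs x)
    N-and-W-nbrs x∈N = ≤-pred (subst (3 ≤_) (degree-split x∈N) (min-degree-3 (N⊆S x∈N)))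

    some-W-nbr : ∀ {x} → x ∈ N → count (N-nbrs x) ≤ 1 → ∃ λ g → g ∈ W-nbrs x
    some-W-nbr {x} x∈N ≤1 = 0<count⇒∃∈ (W-nbrs x)
      (+-cancelˡ-≤ 1 1 _ (≤-trans (N-and-W-nbrs x∈N) (+-monoˡ-≤ (count (W-nbrs x)) ≤1)))

    -- c and W-neighbours of its two N-neighbours (which are leaves) form an independent triple.
    heavy-case : ∀ {c} → c ∈ N → 2 ≤ count (N-nbrs c) → ⊥
    heavy-case {c} c∈N 2≤c
      with l₁ , l₁∈ ← 0<count⇒∃∈ (N-nbrs c) (≤-trans (s≤s z≤n) 2≤c)
      with l₂ , l₂∈ , l₂≢l₁ ← another-member (N-nbrs c) 2≤c l₁
      with g₁ , g₁∈ ← some-W-nbr (N-nbrs⊆N l₁∈) (leaf-of-branching c∈N l₁∈ l₂∈ l₂≢l₁)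
      with g₂ , g₂∈ ← some-W-nbr (N-nbrs⊆N l₂∈) (leaf-of-branching c∈N l₂∈ l₁∈ (≢-sym l₂≢l₁)) =
      no-independent-triple
        (((N⇒W⇒≢ c∈N g₁∈W , c≁g₁) ∷ (N⇒W⇒≢ c∈N g₂∈W , c≁g₂) ∷ []) ∷ ((g₁≢g₂ , g₁≁g₂) ∷ []) ∷ [] ∷ [])
        (N⊆S c∈N ∷ W⊆S g₁∈W ∷ W⊆S g₂∈W ∷ [])
      where
      g₁∈W : g₁ ∈ W
      g₁∈W = W-nbrs⊆W g₁∈
      g₂∈W : g₂ ∈ W
      g₂∈W = W-nbrs⊆W g₂∈
      c≁g₁ : c ≁ g₁
      c≁g₁ = no-W-nbr-of-N-nbr c∈N (N-nbrs⊆N l₁∈) (N-nbrs⊆N l₂∈) g₁∈W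
                               (N-nbrs⇒~ l₁∈) (N-nbrs⇒~ l₂∈) l₂≢l₁ (W-nbrs⇒~ g₁∈)
      c≁g₂ : c ≁ g₂
      c≁g₂ = no-W-nbr-of-N-nbr c∈N (N-nbrs⊆N l₂∈) (N-nbrs⊆N l₁∈) g₂∈W
                               (N-nbrs⇒~ l₂∈) (N-nbrs⇒~ l₁∈) (≢-sym l₂≢l₁) (W-nbrs⇒~ g₂∈)
      g₁≢g₂ : g₁ ≢ g₂
      g₁≢g₂ refl = no-shared-W-nbr (N-nbrs⊆N l₂∈) (N-nbrs⊆N l₁∈) c∈N g₁∈W (~-sym (N-nbrs⇒~ l₁∈))
                                   (W-nbrs⇒~ g₁∈) l₂≢l₁ (~⇒≢ (~-sym (N-nbrs⇒~ l₂∈))) (W-nbrs⇒~ g₂∈)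
      g₁≁g₂ : g₁ ≁ g₂
      g₁≁g₂ = W-nbrs-nonadjacent (N-nbrs⊆N l₁∈) (N-nbrs⊆N l₂∈) g₁∈W g₂∈W
                                 (W-nbrs⇒~ g₁∈) (W-nbrs⇒~ g₂∈) (≢-sym l₂≢l₁) g₁≢g₂

    module _ (light : ∀ {x} → x ∈ N → count (N-nbrs x) ≤ 1) where

      0<count-non-nbrs : ∀ {x} → x ∈ N → 0 < count (N ─ ⁅ x ⁆ ─ adj G x)
      0<count-non-nbrs {x} x∈N = +-cancelˡ-≤ 1 1 _ (begin
        2                                                          ≤⟨ 2≤count-N─x ⟩
        count (N ─ ⁅ x ⁆)                                          ≡⟨ count-split (N ─ ⁅ x ⁆) (adj G x) ⟩
        count (N ─ ⁅ x ⁆ ∩ adj G x) + count (N ─ ⁅ x ⁆ ─ adj G x)  ≤⟨ +-monoˡ-≤ _ count-N─x∩x≤1 ⟩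
        1 + count (N ─ ⁅ x ⁆ ─ adj G x)                            ∎)
        where
        open ≤-Reasoning
        2≤count-N─x : 2 ≤ count (N ─ ⁅ x ⁆)
        2≤count-N─x = ≤-pred (≤-trans (min-degree-3 v∈S) (≤-reflexive (count-─⁅⁆ N x∈N)))
        ⊆N-nbrs : N ─ ⁅ x ⁆ ∩ adj G x ⊆ N-nbrs x
        ⊆N-nbrs y∈ with y∈N─x , x~y ← ∈∩⁻ y∈ = ∈N-nbrs⁺ (proj₁ (∈─⁅⁆⁻ y∈N─x)) x~y
        count-N─x∩x≤1 : count (N ─ ⁅ x ⁆ ∩ adj G x) ≤ 1
        count-N─x∩x≤1 = ≤-trans (count-mono {n} ⊆N-nbrs) (light x∈N)

      non-nbr-in-N : ∀ {x} → x ∈ N → ∃ λ y → y ∈ N × y ≢ x × x ≁ y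
      non-nbr-in-N {x} x∈N
        with y , y∈ ← 0<count⇒∃∈ (N ─ ⁅ x ⁆ ─ adj G x) (0<count-non-nbrs x∈N)
        with y∈N─x , y∉nbr ← ∈─⁻ y∈
        with y∈N , y≢x ← ∈─⁅⁆⁻ y∈N─x = y , y∈N , y≢x , y∉nbr

      W-nbr-avoiding : ∀ {x y h} → x ∈ N → y ∈ N → y ≢ x → x ≁ y → y ~ h →
                       ∃ λ g → g ∈ W-nbrs x × g ≢ h
      W-nbr-avoiding {x} {y} {h} x∈N y∈N y≢x x≁y y~h with count (N-nbrs x) ≟ℕ 0
      ... | yes none =
        another-member (W-nbrs x) (subst (λ c → 2 ≤ c + count (W-nbrs x)) none (N-and-W-nbrs x∈N)) h
      ... | no  some with z , z∈ ← 0<count⇒∃∈ (N-nbrs x) (n≢0⇒n>0 some)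
                     with g , g∈ ← some-W-nbr x∈N (light x∈N) =
        g , g∈ , λ { refl → no-shared-W-nbr y∈N x∈N (N-nbrs⊆N z∈) (W-nbrs⊆W g∈) (N-nbrs⇒~ z∈) (W-nbrs⇒~ g∈)
                              y≢x (λ { refl → x≁y (N-nbrs⇒~ z∈) }) y~h }

      -- v and W-neighbours of two nonadjacent vertices of N form an independent triple.
      light-case : ⊥
      light-case
        with x₁ , x₁∈N ← 0<count⇒∃∈ N (≤-trans (s≤s z≤n) (min-degree-3 v∈S))
        with x₂ , x₂∈N , x₂≢x₁ , x₁≁x₂ ← non-nbr-in-N x₁∈N
        with g₂ , g₂∈ ← some-W-nbr x₂∈N (light x₂∈N)
        with g₁ , g₁∈ , g₁≢g₂ ← W-nbr-avoiding x₁∈N x₂∈N x₂≢x₁ x₁≁x₂ (W-nbrs⇒~ g₂∈) =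
        no-independent-triple
          (((≢-sym (W⇒≢ g₁∈W) , W⇒≁ g₁∈W) ∷ (≢-sym (W⇒≢ g₂∈W) , W⇒≁ g₂∈W) ∷ []) ∷ ((g₁≢g₂ , g₁≁g₂) ∷ []) ∷ [] ∷ [])
          (v∈S ∷ W⊆S g₁∈W ∷ W⊆S g₂∈W ∷ [])
        where
        g₁∈W : g₁ ∈ W
        g₁∈W = W-nbrs⊆W g₁∈
        g₂∈W : g₂ ∈ W
        g₂∈W = W-nbrs⊆W g₂∈
        g₁≁g₂ : g₁ ≁ g₂
        g₁≁g₂ = W-nbrs-nonadjacent x₁∈N x₂∈N g₁∈W g₂∈W (W-nbrs⇒~ g₁∈) (W-nbrs⇒~ g₂∈) (≢-sym x₂≢x₁) g₁≢g₂

    absurd : ⊥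
    absurd with any? (λ c → (c ∈? N) ×-dec (2 ≤? count (N-nbrs c)))
    ... | yes (c , c∈N , 2≤) = heavy-case c∈N 2≤
    ... | no  ∄heavy          = light-case λ x∈N → ≤-pred (≰⇒> λ 2≤ → ∄heavy (_ , x∈N , 2≤))

  α≤2⇒count≤6 : ∀ {S} → K4-free S → α[ S ]≤ 2 → count S ≤ 6
  α≤2⇒count≤6 {S} free α≤2 with 7 ≤? count S
  ... | no  7≰c = ≤-pred (≰⇒> 7≰c)
  ... | yes 7≤c = ⊥-elim (Count≥7.absurd free α≤2 7≤c)

  module MinDegree≥4 {S : FinSet n} {v : Fin n} (v∈S : v ∈ S) (free : K4-free S)
                    (min-degree-4 : ∀ {x} → x ∈ S → 4 ≤ degree S x) where

    open Around {S} {v} v∈S free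

    Light : Fin n → Set
    Light x = count (N-nbrs x) ≡ 1

    light? : ∀ x → Dec (Light x)
    light? x = count (N-nbrs x) ≟ℕ 1

    light⇒2≤W-nbrs : ∀ {x} → x ∈ N → Light x → 2 ≤ count (W-nbrs x)
    light⇒2≤W-nbrs {x} x∈N light = +-cancelˡ-≤ 2 2 _
      (subst (λ c → 4 ≤ suc (c + count (W-nbrs x))) light
        (subst (4 ≤_) (degree-split x∈N) (min-degree-4 (N⊆S x∈N))))

    heavy⇒other-nbr : ∀ {x y} → ¬ Light x → y ∈ N-nbrs x → ∃ λ a → a ∈ N-nbrs x × a ≢ y
    heavy⇒other-nbr {x} {y} heavy y∈ = another-member (N-nbrs x) (2≤ (∈⇒0<count (N-nbrs x) y∈) heavy) y
      where
      2≤ : ∀ {c} → 0 < c → c ≢ 1 → 2 ≤ c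
      2≤ {suc zero}    _ c≢1 = ⊥-elim (c≢1 refl)
      2≤ {suc (suc _)} _ _   = s≤s (s≤s z≤n)

    partner first-W-nbr second-W-nbr : Fin n → Fin n
    partner      x = choose (N-nbrs x) x
    first-W-nbr  x = choose (W-nbrs x) x
    second-W-nbr x = choose (W-nbrs x ─ ⁅ first-W-nbr (partner x) ⁆) x

    partner-∈ : ∀ {x} → Light x → partner x ∈ N-nbrs x
    partner-∈ {x} light = choose-∈ (N-nbrs x) (proj₂ (0<count⇒∃∈ (N-nbrs x) (≤-reflexive (sym light))))

    partner-unique : ∀ {x y} → Light x → y ∈ N-nbrs x → y ≡ partner x
    partner-unique {x} light y∈ = count≤1⇒≡ (N-nbrs x) (≤-reflexive light) y∈ (partner-∈ light)

    first-W-nbr-∈ : ∀ {x} → x ∈ N → Light x → first-W-nbr x ∈ W-nbrs x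
    first-W-nbr-∈ {x} x∈N light =
      choose-∈ (W-nbrs x) (proj₂ (0<count⇒∃∈ (W-nbrs x) (≤-trans (s≤s z≤n) (light⇒2≤W-nbrs x∈N light))))

    second-W-nbr-∈ : ∀ {x} → x ∈ N → Light x →
                     second-W-nbr x ∈ W-nbrs x × second-W-nbr x ≢ first-W-nbr (partner x)
    second-W-nbr-∈ {x} x∈N light
      with g , g∈ , g≢ ← another-member (W-nbrs x) (light⇒2≤W-nbrs x∈N light) (first-W-nbr (partner x)) =
      ∈─⁅⁆⁻ (choose-∈ (W-nbrs x ─ ⁅ first-W-nbr (partner x) ⁆) (∈─⁅⁆⁺ g∈ g≢))

    -- φ maps N injectively onto an independent set: a vertex with ≠ 1 neighbours in N stays, one
    -- with exactly one (its partner) moves to a W-neighbour, and mutual partners are kept apart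
    -- by letting the smaller one take first-W-nbr and the larger one avoid it.
    φ : Fin n → Fin n
    φ x with light? x | x <ᶠ? partner x
    ... | no  _ | _     = x
    ... | yes _ | yes _ = first-W-nbr x
    ... | yes _ | no  _ = second-W-nbr x

    φ-heavy : ∀ {x} → ¬ Light x → φ x ≡ x
    φ-heavy {x} heavy with light? x | x <ᶠ? partner x
    ... | no  _     | _ = refl
    ... | yes light | _ = ⊥-elim (heavy light)

    φ-first : ∀ {x} → Light x → x <ᶠ partner x → φ x ≡ first-W-nbr x
    φ-first {x} light x<p with light? x | x <ᶠ? partner x
    ... | no  heavy | _       = ⊥-elim (heavy light)
    ... | yes _     | yes _   = refl
    ... | yes _     | no  x≮p = ⊥-elim (x≮p x<p)

    φ-second : ∀ {x} → Light x → ¬ x <ᶠ partner x → φ x ≡ second-W-nbr x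
    φ-second {x} light x≮p with light? x | x <ᶠ? partner x
    ... | no  heavy | _       = ⊥-elim (heavy light)
    ... | yes _     | yes x<p = ⊥-elim (x≮p x<p)
    ... | yes _     | no  _   = refl

    φ-light : ∀ {x} → x ∈ N → Light x → φ x ∈ W-nbrs x
    φ-light {x} x∈N light = case x <ᶠ? partner x of λ where
      (yes x<p) → subst (_∈ W-nbrs x) (sym (φ-first light x<p)) (first-W-nbr-∈ x∈N light)
      (no  x≮p) → subst (_∈ W-nbrs x) (sym (φ-second light x≮p)) (proj₁ (second-W-nbr-∈ x∈N light))

    φ-matched-< : ∀ {x y} → y ∈ N → Light x → Light y → partner x ≡ y → partner y ≡ x → x <ᶠ y → φ x ≢ φ y
    φ-matched-< {x} {y} y∈N light-x light-y px≡y py≡x x<y φx≡φy =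
      proj₂ (second-W-nbr-∈ y∈N light-y) (begin
        second-W-nbr y             ≡⟨ sym (φ-second light-y (<ᶠ-asym x<y ∘ subst (y <ᶠ_) py≡x)) ⟩
        φ y                        ≡⟨ sym φx≡φy ⟩
        φ x                        ≡⟨ φ-first light-x (subst (x <ᶠ_) (sym px≡y) x<y) ⟩
        first-W-nbr x              ≡⟨ cong first-W-nbr (sym py≡x) ⟩
        first-W-nbr (partner y)    ∎)
      where open ≡-Reasoning

    ~partner : ∀ {x} → Light x → x ~ partner x
    ~partner = N-nbrs⇒~ ∘ partner-∈

    partner∈N : ∀ {x} → Light x → partner x ∈ N
    partner∈N = N-nbrs⊆N ∘ partner-∈

    ~φ : ∀ {x} → x ∈ N → Light x → x ~ φ x
    ~φ x∈N = W-nbrs⇒~ ∘ φ-light x∈N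

    φ∈W : ∀ {x} → x ∈ N → Light x → φ x ∈ W
    φ∈W x∈N = W-nbrs⊆W ∘ φ-light x∈N

    heavy-heavy : ∀ {x y} → x ∈ N → y ∈ N → ¬ Light x → ¬ Light y → x ≁ y
    heavy-heavy x∈N y∈N heavy-x heavy-y x~y
      with a , a∈ , a≢y ← heavy⇒other-nbr heavy-x (∈N-nbrs⁺ y∈N x~y)
      with b , b∈ , b≢x ← heavy⇒other-nbr heavy-y (∈N-nbrs⁺ x∈N (~-sym x~y)) =
      no-adjacent-branching x∈N y∈N (N-nbrs⊆N a∈) (N-nbrs⊆N b∈) x~y (N-nbrs⇒~ a∈) (N-nbrs⇒~ b∈) a≢y b≢x

    heavy-light : ∀ {x y} → x ∈ N → y ∈ N → x ≢ y → ¬ Light x → Light y → x ≁ φ y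
    heavy-light {x} {y} x∈N y∈N x≢y heavy-x light-y x~φy with x ≟ partner y
    ... | no  x≢p = no-shared-W-nbr x∈N y∈N (partner∈N light-y) (φ∈W y∈N light-y)
                                    (~partner light-y) (~φ y∈N light-y) x≢y x≢p x~φy
    ... | yes refl with a , a∈ , a≢y ← heavy⇒other-nbr heavy-x (∈N-nbrs⁺ y∈N (~-sym (~partner light-y))) =
      no-W-nbr-of-N-nbr x∈N y∈N (N-nbrs⊆N a∈) (φ∈W y∈N light-y) (~-sym (~partner light-y))
                        (N-nbrs⇒~ a∈) a≢y (~φ y∈N light-y) x~φy

    partner-partner : ∀ {x} → x ∈ N → Light x → Light (partner x) → partner (partner x) ≡ x
    partner-partner x∈N light-x light-p =
      sym (partner-unique light-p (∈N-nbrs⁺ x∈N (~-sym (~partner light-x))))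

    φ-matched : ∀ {x y} → x ∈ N → y ∈ N → x ≢ y → Light x → Light y →
                partner x ≡ y → partner y ≡ x → φ x ≢ φ y
    φ-matched {x} {y} x∈N y∈N x≢y light-x light-y px≡y py≡x with <-cmp x y
    ... | tri< x<y _   _   = φ-matched-< y∈N light-x light-y px≡y py≡x x<y
    ... | tri≈ _   x≡y _   = ⊥-elim (x≢y x≡y)
    ... | tri> _   _   y<x = ≢-sym (φ-matched-< x∈N light-y light-x py≡x px≡y y<x)

    light-light : ∀ {x y} → x ∈ N → y ∈ N → x ≢ y → Light x → Light y → φ x ≢ φ y × φ x ≁ φ y
    light-light {x} {y} x∈N y∈N x≢y light-x light-y =
      φx≢φy , W-nbrs-nonadjacent x∈N y∈N (φ∈W x∈N light-x) (φ∈W y∈N light-y)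
                                 (~φ x∈N light-x) (~φ y∈N light-y) x≢y φx≢φy
      where
      φx≢φy : φ x ≢ φ y
      φx≢φy φx≡φy with y ≟ partner x
      ... | no  y≢p  = no-shared-W-nbr y∈N x∈N (partner∈N light-x) (φ∈W x∈N light-x) (~partner light-x)
                                       (~φ x∈N light-x) (≢-sym x≢y) y≢p
                                       (subst (y ~_) (sym φx≡φy) (~φ y∈N light-y))
      ... | yes refl = φ-matched x∈N y∈N x≢y light-x light-y refl (partner-partner x∈N light-x light-y) φx≡φy

    φ-independent : ∀ {x y} → x ∈ N → y ∈ N → x ≢ y → φ x ≢ φ y × φ x ≁ φ y
    φ-independent {x} {y} x∈N y∈N x≢y =
      case light? x ,′ light? y of λ where
        (no heavy-x , no heavy-y) →
          subst₂ (λ a b → a ≢ b × a ≁ b) (sym (φ-heavy heavy-x)) (sym (φ-heavy heavy-y))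
            (x≢y , heavy-heavy x∈N y∈N heavy-x heavy-y)
        (no heavy-x , yes light-y) →
          subst (λ a → a ≢ φ y × a ≁ φ y) (sym (φ-heavy heavy-x))
            (N⇒W⇒≢ x∈N (φ∈W y∈N light-y) , heavy-light x∈N y∈N x≢y heavy-x light-y)
        (yes light-x , no heavy-y) →
          subst (λ b → φ x ≢ b × φ x ≁ b) (sym (φ-heavy heavy-y))
            (≢-sym (N⇒W⇒≢ y∈N (φ∈W x∈N light-x)) , ≁-sym (heavy-light y∈N x∈N (≢-sym x≢y) heavy-y light-x))
        (yes light-x , yes light-y) → light-light x∈N y∈N x≢y light-x light-y

    φ∈S : ∀ {x} → x ∈ N → φ x ∈ S
    φ∈S {x} x∈N = case light? x of λ where
      (no  heavy) → subst (_∈ S) (sym (φ-heavy heavy)) (N⊆S x∈N)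
      (yes light) → W⊆S (φ∈W x∈N light)

    degree≤α : ∀ {m} → α[ S ]≤ m → degree S v ≤ m
    degree≤α α≤m with xs , unique , xs⊆N , len ← enumerate N =
      subst (_≤ _) (trans (length-map φ xs) len)
        (α≤m (AllPairs.map⁺ (AllPairs-map-within φ-independent xs⊆N unique)) (All.map⁺ (All.map φ∈S xs⊆N)))

  -- A counterexample with count S ≥ m + b + 3 has minimum degree ≥ m + 2 ≥ 4, so deg ≤ α ≤ m + 1.
  count-step : ∀ {m b} → 2 ≤ m → (∀ {T} → K4-free T → α[ T ]≤ m → count T ≤ b) →
               ∀ {S} → K4-free S → α[ S ]≤ suc m → count S ≤ suc (suc (m + b))
  count-step {m} {b} 2≤m bound {S} free α≤1+m with suc (suc (suc (m + b))) ≤? count S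
  ... | no  ≰c  = ≤-pred (≰⇒> ≰c)
  ... | yes big with v , v∈S ← 0<count⇒∃∈ S (≤-trans (s≤s z≤n) big) =
    ⊥-elim (ℕ.1+n≰n (≤-trans (min-degree-2+m v∈S) (MinDegree≥4.degree≤α v∈S free min-degree-4 α≤1+m)))
    where
    min-degree-2+m : ∀ {x} → x ∈ S → suc (suc m) ≤ degree S x
    min-degree-2+m = min-degree free α≤1+m bound big
    min-degree-4 : ∀ {x} → x ∈ S → 4 ≤ degree S x
    min-degree-4 = ≤-trans (s≤s (s≤s 2≤m)) ∘ min-degree-2+m

  α≤3⇒count≤10 : ∀ {S} → K4-free S → α[ S ]≤ 3 → count S ≤ 10
  α≤3⇒count≤10 = count-step (s≤s (s≤s z≤n)) α≤2⇒count≤6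

  α≤4⇒count≤15 : ∀ {S} → K4-free S → α[ S ]≤ 4 → count S ≤ 15
  α≤4⇒count≤15 = count-step (s≤s (s≤s z≤n)) α≤3⇒count≤10

  -- Pigeonhole: if every vertex of the K4 had a neighbour in J, two of them would share one.
  K4-vertex-missing : ∀ {k : Fin 4 → Fin n} → IsClique k → ∀ {J} → All (_∉ vertices k) J → length J < 4 →
                      ∃ λ i → All (k i ≁_) J
  K4-vertex-missing {k} k~ {J} J∉k J<4 with all? (λ i → Any.any? (k i ~?_) J)
  ... | no  ¬all = map₂ (All.¬Any⇒All¬ J) (¬∀⟶∃¬ 4 _ (λ i → Any.any? (k i ~?_) J) ¬all)
  ... | yes hit with i , i′ , i<i′ , same-index ← pigeonhole J<4 (λ i → Any.index (hit i)) =
    ⊥-elim (<⇒≢ i<i′ (K4-neighbour-unique k~ (∉vertices (proj₁ (All.lookupAny J∉k (hit i))))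
                                            (~-sym (proj₂ (All.lookupAny J∉k (hit i))))
                                            (~-sym (subst (k i′ ~_) (sym (cong (lookup J) same-index))
                                                                 (proj₂ (All.lookupAny J∉k (hit i′)))))))

  α-─-clique : ∀ {S m} ((k , _) : Clique4 S) → suc m ≤ 3 → α[ S ]≤ suc m → α[ S ─ vertices k ]≤ m
  α-─-clique {S} {m} (k , k~ , k∈S) m<3 α≤1+m {J} indep J⊆
    with i , ki≁J ← K4-vertex-missing k~ (All.map (proj₂ ∘ ∈─⁻) J⊆)
                                        (s≤s (≤-trans (α≤1+m indep (All.map (proj₁ ∘ ∈─⁻) J⊆)) m<3)) =
    ≤-pred (α≤1+m (All.zipWith (λ (y∈ , ki≁y) → ≢-sym (∉vertices (proj₂ (∈─⁻ y∈)) i) , ki≁y) (J⊆ , ki≁J) ∷ indep)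
                  (k∈S i ∷ All.map (proj₁ ∘ ∈─⁻) J⊆))

  K4-free⇒count< : ∀ {S m} → suc m ≤ 3 → K4-free S → α[ S ]≤ suc m → count S < 4 * suc m
  K4-free⇒count< {m = zero}                 _ free α≤ = s≤s (α≤1⇒count≤3 free α≤)
  K4-free⇒count< {m = suc zero}             _ free α≤ = s≤s (≤-trans (α≤2⇒count≤6 free α≤) (n≤1+n _))
  K4-free⇒count< {m = suc (suc zero)}       _ free α≤ = s≤s (≤-trans (α≤3⇒count≤10 free α≤) (n≤1+n _))
  K4-free⇒count< {m = suc (suc (suc _))} (s≤s (s≤s (s≤s ()))) _ _

  greedy-packing : ∀ m → m ≤ 3 → ∀ {S} → α[ S ]≤ m → 4 * m ≤ count S → Packing S m
  greedy-packing zero    _ {S} _ _ = empty-packing {S}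
  greedy-packing (suc m) m<3 {S} α≤1+m 4+4m≤c with clique4? S
  ... | no  free        = ⊥-elim (<⇒≱ (K4-free⇒count< m<3 free α≤1+m) 4+4m≤c)
  ... | yes K@(k , _)   =
    extend-packing {S} K (greedy-packing m (≤-trans (n≤1+n m) m<3) (α-─-clique K m<3 α≤1+m) 4m≤rest)
    where
    4m≤rest : 4 * m ≤ count (S ─ vertices k)
    4m≤rest = +-cancelˡ-≤ 4 _ _
      (≤-trans (subst (_≤ count S) (ℕ.*-suc 4 m) 4+4m≤c) (count-─vertices S k))

  module Star (α≤4 : α[ full ]≤ 4) {k : Fin 4 → Fin n} (k~ : IsClique k)
              (12≤rest : 12 ≤ count (full ─ vertices k)) (L : IndependentSet (full ─ vertices k) 4) where

    V : FinSet n
    V = vertices k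

    no-independent-5 : ∀ {xs} → Independent xs → length xs ≡ 5 → ⊥
    no-independent-5 {xs} indep len = ℕ.1+n≰n (subst (_≤ 4) len (α≤4 indep (⊆full xs)))

    one-K-nbr : ∀ {x i j} → x ∉ V → x ~ k i → x ~ k j → i ≡ j
    one-K-nbr x∉V = K4-neighbour-unique k~ (∉vertices x∉V)

    ls : List (Fin n)
    ls = proj₁ L

    ls-independent : Independent ls
    ls-independent = proj₁ (proj₂ (proj₂ L))

    ls∉V : All (_∉ V) ls
    ls∉V = All.map (proj₂ ∘ ∈─⁻) (proj₂ (proj₂ (proj₂ L)))

    K-nbr-in-ls : ∀ i → Any (k i ~_) ls
    K-nbr-in-ls i with Any.any? (k i ~?_) ls
    ... | yes hit  = hit
    ... | no  miss = ⊥-elim (no-independent-5 (ki-row ∷ ls-independent) (cong suc (proj₁ (proj₂ L))))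
      where
      ki-row : All (λ y → k i ≢ y × k i ≁ y) ls
      ki-row = All.zipWith (λ (y∉V , ki≁y) → ≢-sym (∉vertices y∉V i) , ki≁y) (ls∉V , All.¬Any⇒All¬ ls miss)

    j : Fin 4 → Fin n
    j i = Any.lookup (K-nbr-in-ls i)

    j∉V : ∀ i → j i ∉ V
    j∉V i = proj₁ (All.lookupAny ls∉V (K-nbr-in-ls i))

    k~j : ∀ i → k i ~ j i
    k~j i = proj₂ (All.lookupAny ls∉V (K-nbr-in-ls i))

    j-injective : ∀ {p q} → j p ≡ j q → p ≡ q
    j-injective {p} {q} jp≡jq = one-K-nbr (j∉V p) (~-sym (k~j p)) (subst (_~ k q) (sym jp≡jq) (~-sym (k~j q)))

    j-independent : ∀ {p q} → p ≢ q → j p ≢ j q × j p ≁ j q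
    j-independent p≢q = AllPairs-lookup (λ (x≢y , x≁y) → ≢-sym x≢y , ≁-sym x≁y) ls-independent
                                        (p≢q ∘ j-injective ∘ cong (lookup ls))

    k≁j : ∀ {i p} → p ≢ i → k i ≁ j p
    k≁j {i} {p} p≢i ki~jp = p≢i (one-K-nbr (j∉V p) (~-sym (k~j p)) (~-sym ki~jp))

    some-K-nbr : ∀ {x} → x ∉ V → ∃ λ t → x ~ k t
    some-K-nbr {x} x∉V with any? (λ t → x ~? k t)
    ... | yes found = found
    ... | no  none  with any? (λ i → x ~? j i)
    ...   | no ¬x~j = ⊥-elim (no-independent-5
              ((All.tabulate⁺ (λ i → x≢j i , λ x~ji → ¬x~j (i , x~ji))) ∷ AllPairs.tabulate⁺ j-independent) refl)
      where
      x≢j : ∀ i → x ≢ j i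
      x≢j i refl = none (i , ~-sym (k~j i))
    ...   | yes (i , x~ji) with any? (λ i′ → ¬? (i′ ≟ i) ×-dec (x ~? j i′))
    ...     | yes (i′ , i′≢i , x~ji′) =
              ⊥-elim (no-5-cycle x~ji (~-sym (k~j i)) (k~ (≢-sym i′≢i)) (k~j i′) (~-sym x~ji′)
                                 (∉vertices x∉V i) (∉vertices x∉V i′) (∉vertices (j∉V i) i′)
                                 (proj₁ (j-independent (≢-sym i′≢i))) (≢-sym (∉vertices (j∉V i′) i)))
    ...     | no  only-i = ⊥-elim (no-independent-5 (x-row ∷ ki-row ∷ AllPairs.tabulate⁺ j-rows) refl)
      where
      p : Fin 3 → Fin 4
      p = punchIn i
      x-row : All (λ y → x ≢ y × x ≁ y) (k i ∷ tabulate (j ∘ p))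
      x-row = (∉vertices x∉V i , λ x~ki → none (i , x~ki))
            ∷ All.tabulate⁺ λ r → (λ { refl → none (p r , ~-sym (k~j (p r))) })
                                 , λ x~jp → only-i (p r , punchInᵢ≢i i r , x~jp)
      ki-row : All (λ y → k i ≢ y × k i ≁ y) (tabulate (j ∘ p))
      ki-row = All.tabulate⁺ λ r → ≢-sym (∉vertices (j∉V (p r)) i) , k≁j (punchInᵢ≢i i r)
      j-rows : ∀ {r s} → r ≢ s → j (p r) ≢ j (p s) × j (p r) ≁ j (p s)
      j-rows r≢s = j-independent (r≢s ∘ punchIn-injective i _ _)

    group : Fin 4 → FinSet n
    group i = full ─ V ∩ adj G (k i)

    group∉V : ∀ {i x} → x ∈ group i → x ∉ V
    group∉V = proj₂ ∘ ∈─⁻ ∘ proj₁ ∘ ∈∩⁻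

    group~ : ∀ {i x} → x ∈ group i → k i ~ x
    group~ = proj₂ ∘ ∈∩⁻

    group-vs-j : ∀ {i p x} → x ∈ group i → p ≢ i → x ≢ j p × x ≁ j p
    group-vs-j {i} {p} {x} x∈ p≢i =
      (λ { refl → p≢i (one-K-nbr (j∉V p) (~-sym (k~j p)) (~-sym (group~ x∈))) }) , x≁jp
      where
      x≁jp : x ≁ j p
      x≁jp x~jp with t , _ , t≢p , t≢i , _ ← two-others p≢i =
        no-5-cycle (~-sym (group~ x∈)) (k~ (≢-sym t≢i)) (k~ t≢p) (k~j p) (~-sym x~jp)
                   (∉vertices (group∉V x∈) t) (∉vertices (group∉V x∈) p) (~⇒≢ (k~ (≢-sym p≢i)))
                   (≢-sym (∉vertices (j∉V p) i)) (≢-sym (∉vertices (j∉V p) t))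

    group-clique : ∀ {i x y} → x ∈ group i → y ∈ group i → x ≢ y → x ~ y
    group-clique {i} {x} {y} x∈ y∈ x≢y with x ~? y
    ... | yes x~y = x~y
    ... | no  x≁y = ⊥-elim (no-independent-5 (((x≢y , x≁y) ∷ row x∈) ∷ row y∈ ∷ AllPairs.tabulate⁺ j-rows) refl)
      where
      row : ∀ {z} → z ∈ group i → All (λ y → z ≢ y × z ≁ y) (tabulate (j ∘ punchIn i))
      row z∈ = All.tabulate⁺ λ r → group-vs-j z∈ (punchInᵢ≢i i r)
      j-rows : ∀ {r s} → r ≢ s → j (punchIn i r) ≢ j (punchIn i s) × j (punchIn i r) ≁ j (punchIn i s)
      j-rows r≢s = j-independent (r≢s ∘ punchIn-injective i _ _)

    group≤3 : ∀ i → count (group i) ≤ 3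
    group≤3 i with 4 ≤? count (group i)
    ... | no  4≰c = ≤-pred (≰⇒> 4≰c)
    ... | yes 4≤c with e , e-injective , e∈ ← distinct-members (group i) 4≤c =
      ⊥-elim (no-K5 (group~ (e∈ zero)) (group~ (e∈ (suc zero))) (group~ (e∈ (suc (suc zero))))
                    (group~ (e∈ (suc (suc (suc zero))))) (e~ λ ()) (e~ λ ()) (e~ λ ()) (e~ λ ()) (e~ λ ()) (e~ λ ()))
      where
      e~ : ∀ {r s} → r ≢ s → e r ~ e s
      e~ r≢s = group-clique (e∈ _) (e∈ _) (r≢s ∘ e-injective)

    groups-cover : ∀ i → full ─ V ⊆ group i ∪ ⋃ (group ∘ punchIn i)
    groups-cover i {x} x∈ with t , x~kt ← some-K-nbr (proj₂ (∈─⁻ x∈)) with i ≟ t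
    ... | yes refl = ∈∪⁺ˡ (∈∩⁺ x∈ (~-sym x~kt))
    ... | no  i≢t  = ∈∪⁺ʳ (∈⋃⁺ (group ∘ punchIn i) (punchOut i≢t)
                                 (∈∩⁺ x∈ (subst (λ s → k s ~ x) (sym (punchIn-punchOut i≢t)) (~-sym x~kt))))

    3≤group : ∀ i → 3 ≤ count (group i)
    3≤group i = +-cancelʳ-≤ 9 3 (count (group i)) (begin
      12                                               ≤⟨ 12≤rest ⟩
      count (full ─ V)                                 ≤⟨ count-mono {n} (groups-cover i) ⟩
      count (group i ∪ ⋃ (group ∘ punchIn i))          ≤⟨ count-∪ (group i) _ ⟩
      count (group i) + count (⋃ (group ∘ punchIn i))  ≤⟨ +-monoʳ-≤ (count (group i)) others≤9 ⟩
      count (group i) + 9                              ∎)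
      where
      open ≤-Reasoning
      others≤9 : count (⋃ (group ∘ punchIn i)) ≤ 9
      others≤9 = count-⋃ (group ∘ punchIn i) (group≤3 ∘ punchIn i)

    e : Fin 4 → Fin 3 → Fin n
    e i = proj₁ (distinct-members (group i) (3≤group i))

    e-injective : ∀ i → Injective _≡_ _≡_ (e i)
    e-injective i = proj₁ (proj₂ (distinct-members (group i) (3≤group i)))

    e∈ : ∀ i r → e i r ∈ group i
    e∈ i = proj₂ (proj₂ (distinct-members (group i) (3≤group i)))

    f : Fin 4 × Fin 4 → Fin n
    f (i , zero)  = k i
    f (i , suc r) = e i r

    f~ : ∀ i r s → r ≢ s → f (i , r) ~ f (i , s)
    f~ i zero    zero    0≢0 = ⊥-elim (0≢0 refl)
    f~ i zero    (suc s) _   = group~ (e∈ i s)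
    f~ i (suc r) zero    _   = ~-sym (group~ (e∈ i r))
    f~ i (suc r) (suc s) r≢s = group-clique (e∈ i r) (e∈ i s) (r≢s ∘ cong suc ∘ e-injective i)

    f-injective : Injective _≡_ _≡_ f
    f-injective {i , zero}  {i′ , zero}  eq = cong (_, zero) (clique-injective k~ eq)
    f-injective {i , zero}  {i′ , suc s} eq = ⊥-elim (group∉V (e∈ i′ s) (subst (_∈ V) eq (∈vertices k i)))
    f-injective {i , suc r} {i′ , zero}  eq = ⊥-elim (group∉V (e∈ i r) (subst (_∈ V) (sym eq) (∈vertices k i′)))
    f-injective {i , suc r} {i′ , suc s} eq with one-K-nbr (group∉V (e∈ i r)) (~-sym (group~ (e∈ i r)))
                                                   (subst (_~ k i′) (sym eq) (~-sym (group~ (e∈ i′ s))))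
    ... | refl = cong (λ r → i , suc r) (e-injective i eq)

    4K4 : Has4K4 G
    4K4 = f , f-injective , f~

lemma6 : (G : Graph 16) → ¬ HasC5 G → ¬ HasIndependentSet G 5 → Has4K4 G
lemma6 G no-C5 ∄I₅ = case clique4? full of λ where
    (no  K4-free) → ⊥-elim (ℕ.1+n≰n (subst (_≤ 15) (count-full 16) (α≤4⇒count≤15 K4-free α≤4)))
    (yes K@(k , k~ , _)) → case independent-set? (full ─ vertices k) 4 of λ where
      (yes L)  → Star.4K4 α≤4 k~ (12≤rest k) L
      (no  ∄L) → Packing⇒Has4K4 {full} (extend-packing {full} K
                   (greedy-packing 3 ≤-refl (¬IndependentSet⇒α≤ ∄L) (12≤rest k)))
  where
  open Basics G
  open WithoutC5 {G = G} no-C5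
  α≤4 : α[ full ]≤ 4
  α≤4 = ¬HasIndependentSet⇒α≤ ∄I₅ full
  12≤rest : (k : Fin 4 → Fin 16) → 12 ≤ count (full ─ vertices k)
  12≤rest k =
    +-cancelˡ-≤ 4 12 _ (subst (_≤ 4 + count (full ─ vertices k)) (count-full 16) (count-─vertices full k))
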